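{- Let $k\ge 0$ and $n\ge 0$ be integers. Then $a(n,2k+1)$ equals the number of lattice paths of length $n$ from $(0,0)$ to $(n,0)$ that never go below the $x$-axis, whose height never exceeds $k$, and whose steps are up-steps $(i,j)\to(i+1,j+1)$, down-steps $(i,j)\to(i+1,j-1)$, and horizontal steps $(i,0)\to(i+1,0)$, the horizontal steps being allowed only at height $0$.
   Context: Up-step $U:(i,j)\to(i+1,j+1)$, down-step $D:(i,j)\to(i+1,j-1)$. For integers $n,k\ge 0$, $A_{n,k}$ is the set of lattice paths of length $n$ consisting of $U$ and $D$ steps that start at $(0,0)$, end at height $0$ or $-1$, and stay in the strip $-\lfloor (k+1)/2\rfloor\le y\le \lfloor k/2\rfloor$. Set $a(n,k)=|A_{n,k}|$. -}

module Defs where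

open import Data.Nat using (ℕ; zero; suc; _/_)
open import Data.Integer using (ℤ; +_; -_; _+_; _≤_; _≤?_; 0ℤ; 1ℤ; -1ℤ)
import Data.Integer as ℤ
open import Data.Bool using (Bool; true; false; _∧_; _∨_)
open import Data.List using (List; []; _∷_; length; filterᵇ; map; concatMap)
open import Relation.Nullary.Decidable using (⌊_⌋)

-- Steps: U = (i,j) → (i+1,j+1), D = (i,j) → (i+1,j-1), H = (i,j) → (i+1,j)
data Step : Set where
  U D H : Step

words : List Step → ℕ → List (List Step)
words alph zero    = [] ∷ []
words alph (suc n) = concatMap (λ s → map (s ∷_) (words alph n)) alph

udWords : ℕ → List (List Step)
udWords = words (U ∷ D ∷ [])

udhWords : ℕ → List (List Step)
udhWords = words (U ∷ D ∷ H ∷ [])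

inRange : ℤ → ℤ → ℤ → Bool
inRange lo hi y = ⌊ lo ≤? y ⌋ ∧ ⌊ y ≤? hi ⌋

validA : ℤ → ℤ → ℤ → List Step → Bool
validA lo hi y []      = ⌊ y ℤ.≟ 0ℤ ⌋ ∨ ⌊ y ℤ.≟ -1ℤ ⌋
validA lo hi y (U ∷ w) = inRange lo hi (y + 1ℤ) ∧ validA lo hi (y + 1ℤ) w
validA lo hi y (D ∷ w) = inRange lo hi (y ℤ.- 1ℤ) ∧ validA lo hi (y ℤ.- 1ℤ) w
validA lo hi y (H ∷ w) = false

a : ℕ → ℕ → ℕ
a n k = length (filterᵇ (validA (- (+ (suc k / 2))) (+ (k / 2)) 0ℤ) (udWords n))

validM : ℤ → ℤ → List Step → Bool
validM hi y []      = ⌊ y ℤ.≟ 0ℤ ⌋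
validM hi y (U ∷ w) = inRange 0ℤ hi (y + 1ℤ) ∧ validM hi (y + 1ℤ) w
validM hi y (D ∷ w) = inRange 0ℤ hi (y ℤ.- 1ℤ) ∧ validM hi (y ℤ.- 1ℤ) w
validM hi y (H ∷ w) = ⌊ y ℤ.≟ 0ℤ ⌋ ∧ validM hi y w

motzkinH0 : ℕ → ℕ → ℕ
motzkinH0 n k = length (filterᵇ (validM (+ k) 0ℤ) (udhWords n))

-- Reflecting the negative half of the strip [-(k+1), k] about the line y = -1/2,
-- i.e. sending y < 0 to -1 - y, folds it onto [0, k]. A step between heights 0
-- and -1 becomes a horizontal step at height 0, every other step stays an up or
-- down step, and the end heights 0 and -1 both become 0. Hence the number of
-- strip paths of length n from height y equals the number of Motzkin paths of
-- length n from the folded height, which follows by induction on n from the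
-- first-step recurrences of both counts.
module Submission where

open import Defs
open import Data.Nat using (ℕ; _+_; _*_)
open import Relation.Binary.PropositionalEquality using (_≡_)

open import Data.Nat using (zero; suc; _/_)
open import Data.Nat.Properties using (+-identityʳ; +-comm; +-suc; *-comm)
open import Data.Nat.DivMod using (m*n/n≡m; +-distrib-/-∣ˡ)
open import Data.Nat.Divisibility using (m∣m*n)
open import Data.Integer using (ℤ; +_; -[1+_]; 0ℤ; 1ℤ)
import Data.Integer as ℤ
open import Data.Bool using (Bool; true; false; _∧_; if_then_else_)
open import Data.Bool.Properties using (∧-identityʳ)
open import Data.List using (List; []; _∷_; length; filterᵇ; map; _++_; concatMap)
open import Data.Nat.ListAction using (sum)
open import Data.List.Properties using (length-++; filter-++; map-cong)
open import Function using (_∘_)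
open import Relation.Nullary.Decidable using (⌊_⌋; ⌊⌋-map′)
open import Relation.Binary.PropositionalEquality
  using (refl; sym; trans; cong; cong₂; module ≡-Reasoning)
open ≡-Reasoning

count : {A : Set} → (A → Bool) → List A → ℕ
count p xs = length (filterᵇ p xs)

count-++ : {A : Set} (p : A → Bool) (xs ys : List A) →
           count p (xs ++ ys) ≡ count p xs + count p ys
count-++ p xs ys = trans (cong length (filter-++ _ xs ys)) (length-++ (filterᵇ p xs))

count-map : {A B : Set} (p : B → Bool) (f : A → B) (xs : List A) →
            count p (map f xs) ≡ count (p ∘ f) xs
count-map p f []       = refl
count-map p f (x ∷ xs) with p (f x)
... | true  = cong suc (count-map p f xs)
... | false = count-map p f xs

count-∧ : {A : Set} (b : Bool) (q : A → Bool) (xs : List A) →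
          count (λ x → b ∧ q x) xs ≡ (if b then count q xs else 0)
count-∧ true  q xs       = refl
count-∧ false q []       = refl
count-∧ false q (x ∷ xs) = count-∧ false q xs

count-concatMap : {A B : Set} (p : B → Bool) (f : A → List B) (xs : List A) →
                  count p (concatMap f xs) ≡ sum (map (count p ∘ f) xs)
count-concatMap p f []       = refl
count-concatMap p f (x ∷ xs) =
  trans (count-++ p (f x) _) (cong (_+_ (count p (f x))) (count-concatMap p f xs))

count-words-suc : (p : List Step → Bool) (alph : List Step) (n : ℕ) →
                  count p (words alph (suc n)) ≡
                  sum (map (λ s → count (p ∘ (s ∷_)) (words alph n)) alph)
count-words-suc p alph n =
  trans (count-concatMap p _ alph)
        (cong sum (map-cong (λ s → count-map p (s ∷_) (words alph n)) alph))

module _ (lo hi : ℤ) where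

  countA : ℤ → ℕ → ℕ
  countA y n = count (validA lo hi y) (udWords n)

  countA⁺ : ℤ → ℕ → ℕ
  countA⁺ y n = if inRange lo hi y then countA y n else 0

  countA-suc : (y : ℤ) (n : ℕ) →
               countA y (suc n) ≡ countA⁺ (y ℤ.+ 1ℤ) n + countA⁺ (y ℤ.- 1ℤ) n
  countA-suc y n = begin
    countA y (suc n)
      ≡⟨ count-words-suc (validA lo hi y) (U ∷ D ∷ []) n ⟩
    count (validA lo hi y ∘ (U ∷_)) ws + (count (validA lo hi y ∘ (D ∷_)) ws + 0)
      ≡⟨ cong₂ _+_ (count-∧ (inRange lo hi (y ℤ.+ 1ℤ)) _ ws)
                   (trans (+-identityʳ _) (count-∧ (inRange lo hi (y ℤ.- 1ℤ)) _ ws)) ⟩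
    countA⁺ (y ℤ.+ 1ℤ) n + countA⁺ (y ℤ.- 1ℤ) n ∎
    where ws = udWords n

fold : ℤ → ℤ
fold (+ m)    = + m
fold -[1+ m ] = + m

fold-pred-neg : (m : ℕ) → fold (-[1+ m ] ℤ.- 1ℤ) ≡ + m ℤ.+ 1ℤ
fold-pred-neg m = cong +_ (trans (cong suc (+-identityʳ m)) (+-comm 1 m))

inRange-fold : (k : ℕ) (y : ℤ) → inRange -[1+ k ] (+ k) y ≡ inRange 0ℤ (+ k) (fold y)
inRange-fold k (+ m)    = refl
inRange-fold k -[1+ m ] = trans (∧-identityʳ _) (trans (⌊⌋-map′ _ _ _) (sym (⌊⌋-map′ _ _ _)))

module _ (hi : ℤ) where

  countM : ℤ → ℕ → ℕ
  countM y n = count (validM hi y) (udhWords n)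

  countM⁺ : ℤ → ℕ → ℕ
  countM⁺ y n = if inRange 0ℤ hi y then countM y n else 0

  countM-suc : (y : ℤ) (n : ℕ) →
               countM y (suc n) ≡ countM⁺ (y ℤ.+ 1ℤ) n
                                  + (countM⁺ (y ℤ.- 1ℤ) n + (if ⌊ y ℤ.≟ 0ℤ ⌋ then countM y n else 0))
  countM-suc y n = begin
    countM y (suc n)
      ≡⟨ count-words-suc (validM hi y) (U ∷ D ∷ H ∷ []) n ⟩
    up + (down + (flat + 0))
      ≡⟨ cong₂ _+_ (count-∧ (inRange 0ℤ hi (y ℤ.+ 1ℤ)) _ ws)
                   (cong₂ _+_ (count-∧ (inRange 0ℤ hi (y ℤ.- 1ℤ)) _ ws)
                              (trans (+-identityʳ flat) (count-∧ ⌊ y ℤ.≟ 0ℤ ⌋ _ ws))) ⟩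
    countM⁺ (y ℤ.+ 1ℤ) n + (countM⁺ (y ℤ.- 1ℤ) n + (if ⌊ y ℤ.≟ 0ℤ ⌋ then countM y n else 0)) ∎
    where
      ws = udhWords n
      up = count (validM hi y ∘ (U ∷_)) ws
      down = count (validM hi y ∘ (D ∷_)) ws
      flat = count (validM hi y ∘ (H ∷_)) ws

  countM-suc-zero : (n : ℕ) → countM 0ℤ (suc n) ≡ countM⁺ 1ℤ n + countM 0ℤ n
  countM-suc-zero n = countM-suc 0ℤ n

  countM-suc-pos : (m n : ℕ) →
                   countM (+ suc m) (suc n) ≡ countM⁺ (+ suc m ℤ.+ 1ℤ) n + countM⁺ (+ m) n
  countM-suc-pos m n =
    trans (countM-suc (+ suc m) n) (cong (_+_ (countM⁺ (+ suc m ℤ.+ 1ℤ) n)) (+-identityʳ _))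

module _ (k : ℕ) where

  private
    A A⁺ M M⁺ : ℤ → ℕ → ℕ
    A  = countA -[1+ k ] (+ k)
    A⁺ = countA⁺ -[1+ k ] (+ k)
    M  = countM (+ k)
    M⁺ = countM⁺ (+ k)

  countM-suc-fold : (y : ℤ) (n : ℕ) →
                    M⁺ (fold (y ℤ.+ 1ℤ)) n + M⁺ (fold (y ℤ.- 1ℤ)) n ≡ M (fold y) (suc n)
  countM-suc-fold (+ zero)     n = sym (countM-suc-zero (+ k) n)
  countM-suc-fold (+ suc m)    n = sym (countM-suc-pos (+ k) m n)
  countM-suc-fold -[1+ zero ]  n = trans (+-comm (M 0ℤ n) _) (sym (countM-suc-zero (+ k) n))
  countM-suc-fold -[1+ suc m ] n = begin
    M⁺ (+ m) n + M⁺ (fold (-[1+ suc m ] ℤ.- 1ℤ)) n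
      ≡⟨ cong (λ z → M⁺ (+ m) n + M⁺ z n) (fold-pred-neg (suc m)) ⟩
    M⁺ (+ m) n + M⁺ (+ suc m ℤ.+ 1ℤ) n
      ≡⟨ +-comm (M⁺ (+ m) n) _ ⟩
    M⁺ (+ suc m ℤ.+ 1ℤ) n + M⁺ (+ m) n
      ≡⟨ countM-suc-pos (+ k) m n ⟨
    M (+ suc m) (suc n) ∎

  countA⁺-fold : (y : ℤ) (n : ℕ) → A y n ≡ M (fold y) n → A⁺ y n ≡ M⁺ (fold y) n
  countA⁺-fold y n eq rewrite inRange-fold k y =
    cong (if inRange 0ℤ (+ k) (fold y) then_else 0) eq

  countA-fold : (n : ℕ) (y : ℤ) → A y n ≡ M (fold y) n
  countA-fold zero    (+ zero)       = refl
  countA-fold zero    (+ suc m)      = refl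
  countA-fold zero    -[1+ zero ]    = refl
  countA-fold zero    -[1+ suc m ]   = refl
  countA-fold (suc n) y = begin
    A y (suc n)
      ≡⟨ countA-suc -[1+ k ] (+ k) y n ⟩
    A⁺ (y ℤ.+ 1ℤ) n + A⁺ (y ℤ.- 1ℤ) n
      ≡⟨ cong₂ _+_ (countA⁺-fold (y ℤ.+ 1ℤ) n (countA-fold n (y ℤ.+ 1ℤ)))
                   (countA⁺-fold (y ℤ.- 1ℤ) n (countA-fold n (y ℤ.- 1ℤ))) ⟩
    M⁺ (fold (y ℤ.+ 1ℤ)) n + M⁺ (fold (y ℤ.- 1ℤ)) n
      ≡⟨ countM-suc-fold y n ⟩
    M (fold y) (suc n) ∎

half-double : (k : ℕ) → 2 * k / 2 ≡ k
half-double k = trans (cong (_/ 2) (*-comm 2 k)) (m*n/n≡m k 2)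

half-odd : (k : ℕ) → (2 * k + 1) / 2 ≡ k
half-odd k = begin
  (2 * k + 1) / 2   ≡⟨ +-distrib-/-∣ˡ 1 (m∣m*n k) ⟩
  2 * k / 2 + 0     ≡⟨ +-identityʳ _ ⟩
  2 * k / 2         ≡⟨ half-double k ⟩
  k                 ∎

half-even : (k : ℕ) → suc (2 * k + 1) / 2 ≡ suc k
half-even k = begin
  suc (2 * k + 1) / 2   ≡⟨ cong (_/ 2) (+-suc (2 * k) 1) ⟨
  (2 * k + 2) / 2       ≡⟨ +-distrib-/-∣ˡ 2 (m∣m*n k) ⟩
  2 * k / 2 + 1         ≡⟨ cong (_+ 1) (half-double k) ⟩
  k + 1                 ≡⟨ +-comm k 1 ⟩
  suc k                 ∎

proposition1 : (k n : ℕ) → a n (2 * k + 1) ≡ motzkinH0 n k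
proposition1 k n = begin
  a n (2 * k + 1)
    ≡⟨ cong₂ (λ l h → countA (ℤ.- + l) (+ h) 0ℤ n) (half-even k) (half-odd k) ⟩
  countA -[1+ k ] (+ k) 0ℤ n
    ≡⟨ countA-fold k n 0ℤ ⟩
  motzkinH0 n k ∎
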